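{- Let $i,j\ge 0$ be integers. There is a bijection $\phi$ from the set of pairs of partitions $(\alpha,\beta)$, where $\alpha$ has exactly $i$ distinct parts and $\beta$ has exactly $j$ parts, onto the set of pairs of partitions $(\mu,\nu)$, where $\mu$ has exactly $i+j$ parts and $\nu$ has exactly $i$ distinct parts, each part of $\nu$ being $\le i+j-1$. Moreover, whenever $\phi(\alpha,\beta)=(\mu,\nu)$ we have $|\alpha|+|\beta|=|\mu|+|\nu|$.
   Context: A partition $\lambda=(\lambda_1,\dots,\lambda_r)$ is a finite sequence of integers with $\lambda_1\ge\lambda_2\ge\cdots\ge\lambda_r\ge 0$; zero parts are allowed and are counted among the parts. Its length (number of parts) is $l(\lambda)=r$ and its weight is $|\lambda|=\lambda_1+\cdots+\lambda_r$. A partition has distinct parts if $\lambda_1>\lambda_2>\cdots>\lambda_r$. -}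

module Defs where

open import Data.Nat using (ℕ; _+_; _∸_; _≤_; _≥_; _>_)
open import Data.Vec using (Vec; sum)
open import Data.Vec.Relation.Unary.Linked using (Linked)
open import Data.Vec.Relation.Unary.All using (All)
open import Data.Product using (Σ; _×_; _,_; proj₁; proj₂)

-- A partition with exactly r parts (zero parts allowed): a weakly
-- decreasing vector of naturals of length r.
Partition : ℕ → Set
Partition r = Σ (Vec ℕ r) (Linked _≥_)

DistinctPartition : ℕ → Set
DistinctPartition r = Σ (Vec ℕ r) (Linked _>_)

BoundedDistinctPartition : ℕ → ℕ → Set
BoundedDistinctPartition r b =
  Σ (Vec ℕ r) (λ v → Linked _>_ v × All (_≤ b) v)

weight : ∀ {r} → Vec ℕ r → ℕ
weight = sum

Domain : ℕ → ℕ → Set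
Domain i j = DistinctPartition i × Partition j

Codomain : ℕ → ℕ → Set
Codomain i j = Partition (i + j) × BoundedDistinctPartition i (i + j ∸ 1)

weightD : ∀ {i j} → Domain i j → ℕ
weightD (α , β) = weight (proj₁ α) + weight (proj₁ β)

weightC : ∀ {i j} → Codomain i j → ℕ
weightC (μ , ν) = weight (proj₁ μ) + weight (proj₁ ν)

-- A partition with n parts whose consecutive parts differ by at least k is
-- determined by its gaps (d₁, …, dₙ) ∈ ℕⁿ: its smallest part, followed by the
-- excesses over k of the successive differences going up.  Its weight is
-- n d₁ + (n − 1) d₂ + ⋯ + dₙ + k·n(n − 1)/2.  So α (k = 1), β and μ (k = 0)
-- become arbitrary gap vectors r ∈ ℕⁱ, s ∈ ℕʲ and t ∈ ℕ^(i+j).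
--
-- The pair (r, s) is merged into t by comparing leading gaps a and b: if b ≤ a,
-- emit b and continue with a − b in place of a; otherwise emit a and continue
-- with b − a − 1 in place of b.  Recording the side of each step gives a shuffle
-- of i left and j right steps, and ν lists, for each left step, the number of
-- steps after it: i distinct numbers below i + j.  At a left step followed by
-- i left and j right steps, the new part i + j of ν is paid for by the i of
-- the triangular part of |α| and by the −1 taken off b, which the weight of
-- the remaining s counts j times.

module Submission where

open import Defs
open import Data.Nat using (ℕ; zero; suc; _+_; _*_; _∸_; _≤_; _<_; _>_; z≤n; s≤s; _≤?_; _≟_)
open import Data.Nat.Properties
open import Data.Nat.Tactic.RingSolver using (solve-∀)
open import Data.Vec using (Vec; []; _∷_; _∷ʳ_; map; sum; init; last; initLast)
open import Data.Vec.Properties using (init-∷ʳ; last-∷ʳ; map-∘; map-cong; map-id)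
open import Data.Vec.Relation.Unary.Linked using (Linked; []; [-]; _∷_)
import Data.Vec.Relation.Unary.Linked as Linked
import Data.Vec.Relation.Unary.Linked.Properties as Linkedₚ
open import Data.Vec.Relation.Unary.All using (All; []; _∷_)
import Data.Vec.Relation.Unary.All as All
import Data.Vec.Relation.Unary.All.Properties as Allₚ
open import Data.Product using (Σ; _×_; _,_; proj₁; proj₂)
import Data.Product as Product
open import Data.Product.Properties using (Σ-≡,≡→≡)
open import Data.Product.Function.NonDependent.Propositional using (_×-↔_)
open import Function.Base using (_⟨_⟩_)
open import Function.Bundles using (_⤖_; _↔_; Bijection; Inverse; mk↔ₛ′)
open import Function.Properties.Inverse using (↔⇒⤖; ↔-trans; ↔-sym)
open import Relation.Binary.Definitions using (Transitive)
open import Relation.Nullary using (yes; no)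
open import Relation.Nullary.Negation using (contradiction)
open import Relation.Binary.PropositionalEquality
open import Algebra.Properties.CommutativeSemigroup +-commutativeSemigroup
  using () renaming (interchange to +-interchange; x∙yz≈y∙xz to +-left-comm)

private variable
  A : Set
  i j k n : ℕ
  x y : ℕ

module _ {R : A → A → Set} where

  ∷ʳ⁺ : ∀ {a} {xs : Vec A n} → Linked R xs → All (λ b → R b a) xs → Linked R (xs ∷ʳ a)
  ∷ʳ⁺ {xs = []}         _       _       = [-]
  ∷ʳ⁺ {xs = _ ∷ []}     _       (r ∷ _) = r ∷ [-]
  ∷ʳ⁺ {xs = _ ∷ _ ∷ _}  (r ∷ l) (_ ∷ a) = r ∷ ∷ʳ⁺ l a

  ∷ʳ⁻ : ∀ {a} {xs : Vec A n} → Linked R (xs ∷ʳ a) → Linked R xs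
  ∷ʳ⁻ {xs = []}        _       = []
  ∷ʳ⁻ {xs = _ ∷ []}    _       = [-]
  ∷ʳ⁻ {xs = _ ∷ _ ∷ _} (r ∷ l) = r ∷ ∷ʳ⁻ l

  ∷ʳ⇒All : Transitive R → ∀ {a} {xs : Vec A n} → Linked R (xs ∷ʳ a) → All (λ b → R b a) xs
  ∷ʳ⇒All trans {xs = []}        _       = []
  ∷ʳ⇒All trans {xs = _ ∷ []}    (r ∷ _) = r ∷ []
  ∷ʳ⇒All trans {xs = _ ∷ _ ∷ _} (r ∷ l) = trans r (All.head rest) ∷ rest
    where rest = ∷ʳ⇒All trans l

  ∷⁺ : ∀ {a} {xs : Vec A n} → All (R a) xs → Linked R xs → Linked R (a ∷ xs)
  ∷⁺ []      _ = [-]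
  ∷⁺ (r ∷ _) l = r ∷ l

  ∷⇒All : Transitive R → ∀ {a} {xs : Vec A n} → Linked R (a ∷ xs) → All (R a) xs
  ∷⇒All trans {xs = []}    _       = []
  ∷⇒All trans {xs = _ ∷ _} (r ∷ l) = Linkedₚ.Linked⇒All trans r l

init-∷ʳ-last : (v : Vec A (suc n)) → v ≡ init v ∷ʳ last v
init-∷ʳ-last v = proj₂ (proj₂ (initLast v))

sum-∷ʳ : (xs : Vec ℕ n) → sum (xs ∷ʳ x) ≡ sum xs + x
sum-∷ʳ {x = x} []       = +-comm x 0
sum-∷ʳ {x = x} (y ∷ xs) = trans (cong (y +_) (sum-∷ʳ xs)) (sym (+-assoc y (sum xs) x))

sum-map-+ : ∀ c (xs : Vec ℕ n) → sum (map (c +_) xs) ≡ n * c + sum xs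
sum-map-+ c []       = refl
sum-map-+ {suc n} c (x ∷ xs) = begin
  c + x + sum (map (c +_) xs) ≡⟨ cong (c + x +_) (sum-map-+ c xs) ⟩
  c + x + (n * c + sum xs)    ≡⟨ +-interchange c x (n * c) (sum xs) ⟩
  c + n * c + (x + sum xs)    ∎
  where open ≡-Reasoning

map-∸-map-+ : ∀ c (xs : Vec ℕ n) → map (_∸ c) (map (c +_) xs) ≡ xs
map-∸-map-+ c xs = trans (sym (map-∘ _ _ xs)) (trans (map-cong (m+n∸m≡n c) xs) (map-id xs))

map-+-map-∸ : ∀ c {xs : Vec ℕ n} → All (c ≤_) xs → map (c +_) (map (_∸ c) xs) ≡ xs
map-+-map-∸ c []       = refl
map-+-map-∸ c (p ∷ ps) = cong₂ _∷_ (m+[n∸m]≡n p) (map-+-map-∸ c ps)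

-- Partitions with minimal difference k and their gaps

infix 4 _≥[_]_

_≥[_]_ : ℕ → ℕ → ℕ → Set
x ≥[ k ] y = k + y ≤ x

≥[]-trans : ∀ {k} → Transitive (_≥[ k ]_)
≥[]-trans {k} {_} {y} x≥y y≥z = ≤-trans y≥z (≤-trans (m≤n+m y k) x≥y)

+-mono-≥[] : ∀ c → x ≥[ k ] y → c + x ≥[ k ] c + y
+-mono-≥[] {x} {k} {y} c x≥y = ≤-trans (≤-reflexive (+-left-comm k c y)) (+-monoʳ-≤ c x≥y)

∸-mono-≥[] : ∀ {c} → c ≤ y → x ≥[ k ] y → x ∸ c ≥[ k ] y ∸ c
∸-mono-≥[] {y} {x} {k} {c} c≤y x≥y = subst (_≤ x ∸ c) (+-∸-assoc k c≤y) (∸-monoˡ-≤ c x≥y)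

Spaced : ℕ → ℕ → Set
Spaced k n = Σ (Vec ℕ n) (Linked (_≥[ k ]_))

map-+-spaced : ∀ c {xs : Vec ℕ n} → Linked (_≥[ k ]_) xs → Linked (_≥[ k ]_) (map (c +_) xs)
map-+-spaced {k = k} c l = Linkedₚ.map⁺ (Linked.map (+-mono-≥[] {k = k} c) l)

map-∸-spaced : ∀ {c} {xs : Vec ℕ n} → All (c ≤_) xs → Linked (_≥[ k ]_) xs → Linked (_≥[ k ]_) (map (_∸ c) xs)
map-∸-spaced _                []      = []
map-∸-spaced _                [-]     = [-]
map-∸-spaced (_ ∷ c≤y ∷ c≤ys) (r ∷ l) = ∸-mono-≥[] c≤y r ∷ map-∸-spaced (c≤y ∷ c≤ys) l

fromGaps : ℕ → Vec ℕ n → Vec ℕ n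
fromGaps k []       = []
fromGaps k (d ∷ ds) = map ((k + d) +_) (fromGaps k ds) ∷ʳ d

toGaps : ℕ → Vec ℕ n → Vec ℕ n
toGaps {zero}  k [] = []
toGaps {suc n} k v  = last v ∷ toGaps k (map (_∸ (k + last v)) (init v))

weightedSum : Vec ℕ n → ℕ
weightedSum []               = 0
weightedSum {suc n} (d ∷ ds) = suc n * d + weightedSum ds

triangle : ℕ → ℕ
triangle zero    = 0
triangle (suc n) = n + triangle n

fromGaps-spaced : ∀ k (ds : Vec ℕ n) → Linked (_≥[ k ]_) (fromGaps k ds)
fromGaps-spaced k []       = []
fromGaps-spaced k (d ∷ ds) =
  ∷ʳ⁺ (map-+-spaced (k + d) (fromGaps-spaced k ds)) (Allₚ.map⁺ (All.universal (m≤m+n (k + d)) _))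

sum-fromGaps : ∀ k (ds : Vec ℕ n) → sum (fromGaps k ds) ≡ weightedSum ds + k * triangle n
sum-fromGaps k []               = sym (*-zeroʳ k)
sum-fromGaps {suc n} k (d ∷ ds) = begin
  sum (map ((k + d) +_) (fromGaps k ds) ∷ʳ d)            ≡⟨ sum-∷ʳ (map ((k + d) +_) (fromGaps k ds)) ⟩
  sum (map ((k + d) +_) (fromGaps k ds)) + d             ≡⟨ cong (_+ d) (sum-map-+ (k + d) (fromGaps k ds)) ⟩
  n * (k + d) + sum (fromGaps k ds) + d                  ≡⟨ cong (λ s → n * (k + d) + s + d) (sum-fromGaps k ds) ⟩
  n * (k + d) + (weightedSum ds + k * triangle n) + d    ≡⟨ regroup n k d (weightedSum ds) (triangle n) ⟩
  suc n * d + weightedSum ds + k * (n + triangle n)      ∎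
  where
  open ≡-Reasoning
  regroup : ∀ n k d w t → n * (k + d) + (w + k * t) + d ≡ suc n * d + w + k * (n + t)
  regroup = solve-∀

toGaps-fromGaps : ∀ k (ds : Vec ℕ n) → toGaps k (fromGaps k ds) ≡ ds
toGaps-fromGaps k []       = refl
toGaps-fromGaps k (d ∷ ds)
  rewrite last-∷ʳ d (map ((k + d) +_) (fromGaps k ds))
        | init-∷ʳ d (map ((k + d) +_) (fromGaps k ds))
        | map-∸-map-+ (k + d) (fromGaps k ds) = cong (d ∷_) (toGaps-fromGaps k ds)

fromGaps-toGaps : ∀ k (v : Vec ℕ n) → Linked (_≥[ k ]_) v → fromGaps k (toGaps k v) ≡ v
fromGaps-toGaps {zero}  k [] _ = refl
fromGaps-toGaps {suc n} k v  l = begin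
  map (c +_) (fromGaps k (toGaps k (map (_∸ c) (init v)))) ∷ʳ last v  ≡⟨ cong (λ u → map (c +_) u ∷ʳ last v) IH ⟩
  map (c +_) (map (_∸ c) (init v)) ∷ʳ last v                           ≡⟨ cong (_∷ʳ last v) (map-+-map-∸ c c≤init) ⟩
  init v ∷ʳ last v                                                     ≡⟨ sym (init-∷ʳ-last v) ⟩
  v                                                                    ∎
  where
  open ≡-Reasoning
  c = k + last v
  l′ : Linked (_≥[ k ]_) (init v ∷ʳ last v)
  l′ = subst (Linked _) (init-∷ʳ-last v) l
  c≤init : All (c ≤_) (init v)
  c≤init = ∷ʳ⇒All ≥[]-trans l′
  IH = fromGaps-toGaps k (map (_∸ c) (init v)) (map-∸-spaced c≤init (∷ʳ⁻ l′))

spaced↔gaps : ∀ k n → Spaced k n ↔ Vec ℕ n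
spaced↔gaps k n = mk↔ₛ′ (λ (v , _) → toGaps k v) (λ ds → fromGaps k ds , fromGaps-spaced k ds)
  (toGaps-fromGaps k)
  (λ (v , l) → Σ-≡,≡→≡ (fromGaps-toGaps k v l , Linked.irrelevant ≤-irrelevant _ _))

sum-spaced : ∀ k (v : Vec ℕ n) → Linked (_≥[ k ]_) v → sum v ≡ weightedSum (toGaps k v) + k * triangle n
sum-spaced k v l = trans (cong sum (sym (fromGaps-toGaps k v l))) (sum-fromGaps k (toGaps k v))

-- Shuffles and the positions of their left steps

data Shuffle : ℕ → ℕ → Set where
  []    : Shuffle 0 0
  left  : Shuffle i j → Shuffle (suc i) j
  right : Shuffle i j → Shuffle i (suc j)

positions : Shuffle i j → Vec ℕ i
positions []               = []
positions (left {i} {j} σ) = i + j ∷ positions σ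
positions (right σ)        = positions σ

positions-< : (σ : Shuffle i j) → All (_< i + j) (positions σ)
positions-< []                = []
positions-< (left σ)          = ≤-refl ∷ All.map m<n⇒m<1+n (positions-< σ)
positions-< (right {i} {j} σ) = All.map (λ p → <-trans p (+-monoʳ-< i (n<1+n j))) (positions-< σ)

positions-decreasing : (σ : Shuffle i j) → Linked _>_ (positions σ)
positions-decreasing []        = []
positions-decreasing (left σ)  = ∷⁺ (positions-< σ) (positions-decreasing σ)
positions-decreasing (right σ) = positions-decreasing σ

toShuffle : ∀ i j → Vec ℕ i → Shuffle i j
toShuffle zero    zero    _       = []
toShuffle zero    (suc j) v       = right (toShuffle zero j v)
toShuffle (suc i) zero    (_ ∷ v) = left (toShuffle i zero v)
toShuffle (suc i) (suc j) (x ∷ v) with x ≟ i + suc j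
... | yes _ = left (toShuffle i (suc j) v)
... | no  _ = right (toShuffle (suc i) j (x ∷ v))

toShuffle-right : ∀ i j (v : Vec ℕ (suc i)) → All (_< suc i + j) v →
                  toShuffle (suc i) (suc j) v ≡ right (toShuffle (suc i) j v)
toShuffle-right i j (x ∷ _) (x< ∷ _) with x ≟ i + suc j
... | yes x≡ = contradiction (trans x≡ (+-suc i j)) (<⇒≢ x<)
... | no  _  = refl

toShuffle-positions : (σ : Shuffle i j) → toShuffle i j (positions σ) ≡ σ
toShuffle-positions []                     = refl
toShuffle-positions (left {i} {zero} σ)    = cong left (toShuffle-positions σ)
toShuffle-positions (left {i} {suc j} σ) with i + suc j ≟ i + suc j
... | yes _ = cong left (toShuffle-positions σ)
... | no  ≢ = contradiction refl ≢
toShuffle-positions (right {zero} σ)       = cong right (toShuffle-positions σ)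
toShuffle-positions (right {suc i} {j} σ)  =
  trans (toShuffle-right i j (positions σ) (positions-< σ)) (cong right (toShuffle-positions σ))

length≤head : ∀ {xs : Vec ℕ n} → Linked _>_ (x ∷ xs) → n ≤ x
length≤head {xs = []}    _       = z≤n
length≤head {xs = _ ∷ _} (r ∷ l) = ≤-<-trans (length≤head l) r

>-trans : Transitive _>_
>-trans x>y y>z = <-trans y>z x>y

positions-toShuffle : ∀ i j (v : Vec ℕ i) → Linked _>_ v → All (_< i + j) v → positions (toShuffle i j v) ≡ v
positions-toShuffle zero    zero    []      _ _ = refl
positions-toShuffle zero    (suc j) []      _ _ = positions-toShuffle zero j [] [] []
positions-toShuffle (suc i) zero    (x ∷ v) l (x< ∷ _) =
  cong₂ _∷_ (sym x≡i) (positions-toShuffle i zero v (Linked.tail l) v<i)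
  where
  x≡i : x ≡ i + 0
  x≡i = ≤-antisym (≤-pred x<) (≤-trans (≤-reflexive (+-identityʳ i)) (length≤head l))
  v<i : All (_< i + 0) v
  v<i = subst (λ m → All (_< m) v) x≡i (∷⇒All >-trans l)
positions-toShuffle (suc i) (suc j) (x ∷ v) l (x< ∷ _) with x ≟ i + suc j
... | yes refl = cong (x ∷_) (positions-toShuffle i (suc j) v (Linked.tail l) (∷⇒All >-trans l))
... | no  x≢   = positions-toShuffle (suc i) j (x ∷ v) l (x<′ ∷ All.map (λ y<x → <-trans y<x x<′) (∷⇒All >-trans l))
  where
  x<′ : x < suc i + j
  x<′ = subst (x <_) (+-suc i j) (≤∧≢⇒< (≤-pred x<) x≢)

m<n⇒m≤n∸1 : x < y → x ≤ y ∸ 1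
m<n⇒m≤n∸1 (s≤s x≤y) = x≤y

All-≤∸1⇒< : ∀ i j {v : Vec ℕ i} → All (_≤ i + j ∸ 1) v → All (_< i + j) v
All-≤∸1⇒< zero    j [] = []
All-≤∸1⇒< (suc i) j bs = All.map s≤s bs

shuffle↔positions : ∀ i j → Shuffle i j ↔ BoundedDistinctPartition i (i + j ∸ 1)
shuffle↔positions i j = mk↔ₛ′
  (λ σ → positions σ , positions-decreasing σ , All.map m<n⇒m≤n∸1 (positions-< σ))
  (λ (v , _) → toShuffle i j v)
  (λ (v , l , b) → Σ-≡,≡→≡ (positions-toShuffle i j v l (All-≤∸1⇒< i j b) ,
                            cong₂ _,_ (Linked.irrelevant <-irrelevant _ _) (All.irrelevant ≤-irrelevant _ _)))
  toShuffle-positions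

-- Merging two gap vectors

addHead : ℕ → Vec ℕ n → Vec ℕ n
addHead c []       = []
addHead c (y ∷ ys) = y + c ∷ ys

m+1+n≡1+o⇒m+n≡o : ∀ m {n o} → m + suc n ≡ suc o → m + n ≡ o
m+1+n≡1+o⇒m+n≡o m {n} e = suc-injective (trans (sym (+-suc m n)) e)

-- The length is an index n with i + j ≡ n because i + suc j is not a constructor form.
merge : i + j ≡ n → Vec ℕ i × Vec ℕ j → Vec ℕ n × Shuffle i j
merge {n = zero} _ ([] , []) = [] , []
merge {n = zero} () (_ ∷ _ , _)
merge {n = zero} () ([] , _ ∷ _)
merge {n = suc n} e (a ∷ r , []) = Product.map (a ∷_) left (merge (suc-injective e) (r , []))
merge {n = suc n} e ([] , b ∷ s) = Product.map (b ∷_) right (merge (m+1+n≡1+o⇒m+n≡o 0 e) ([] , s))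
merge {n = suc n} e (a ∷ r , b ∷ s) with b ≤? a
... | yes _ = Product.map (b ∷_) right (merge (m+1+n≡1+o⇒m+n≡o (suc _) e) (a ∸ b ∷ r , s))
... | no  _ = Product.map (a ∷_) left  (merge (suc-injective e) (r , b ∸ suc a ∷ s))

split : i + j ≡ n → Vec ℕ n × Shuffle i j → Vec ℕ i × Vec ℕ j
split _ ([] , [])             = [] , []
split () (_ ∷ _ , [])
split () ([] , left _)
split e ([] , right {i} _)    = contradiction e (m+1+n≢0 i)
split e (c ∷ t , left σ)      = Product.map (c ∷_) (addHead (suc c)) (split (suc-injective e) (t , σ))
split e (c ∷ t , right {i} σ) = Product.map (addHead c) (c ∷_) (split (m+1+n≡1+o⇒m+n≡o i e) (t , σ))

merge-left : ∀ (e : suc i + j ≡ suc n) c r (s : Vec ℕ j) →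
             merge e (c ∷ r , addHead (suc c) s) ≡ Product.map (c ∷_) left (merge (suc-injective e) (r , s))
merge-left e c r []      = refl
merge-left e c r (b ∷ s) with b + suc c ≤? c
... | yes b+c≤c = contradiction b+c≤c (<⇒≱ (m≤n+m (suc c) b))
... | no  _     = cong (λ b′ → Product.map (c ∷_) left (merge (suc-injective e) (r , b′ ∷ s))) (m+n∸n≡m b (suc c))

merge-right : ∀ (e : i + suc j ≡ suc n) c (r : Vec ℕ i) s →
              merge e (addHead c r , c ∷ s) ≡ Product.map (c ∷_) right (merge (m+1+n≡1+o⇒m+n≡o i e) (r , s))
merge-right e c []      s = refl
merge-right e c (a ∷ r) s with c ≤? a + c
... | yes _   = cong (λ a′ → Product.map (c ∷_) right (merge (m+1+n≡1+o⇒m+n≡o (suc _) e) (a′ ∷ r , s))) (m+n∸n≡m a c)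
... | no  c≰a = contradiction (m≤n+m c a) c≰a

merge-split : ∀ (e : i + j ≡ n) (tσ : Vec ℕ n × Shuffle i j) → merge e (split e tσ) ≡ tσ
merge-split {n = zero} _ ([] , []) = refl
merge-split () (_ ∷ _ , [])
merge-split () ([] , left _)
merge-split e ([] , right {i} _)    = contradiction e (m+1+n≢0 i)
merge-split e (c ∷ t , left σ)      =
  trans (merge-left e c _ _) (cong (Product.map (c ∷_) left) (merge-split (suc-injective e) (t , σ)))
merge-split e (c ∷ t , right {i} σ) =
  trans (merge-right e c _ _) (cong (Product.map (c ∷_) right) (merge-split (m+1+n≡1+o⇒m+n≡o i e) (t , σ)))

split-merge : ∀ (e : i + j ≡ n) (rs : Vec ℕ i × Vec ℕ j) → split e (merge e rs) ≡ rs
split-merge {n = zero} _ ([] , []) = refl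
split-merge {n = zero} () (_ ∷ _ , _)
split-merge {n = zero} () ([] , _ ∷ _)
split-merge {n = suc n} e (a ∷ r , []) =
  cong (Product.map (a ∷_) (addHead (suc a))) (split-merge (suc-injective e) (r , []))
split-merge {n = suc n} e ([] , b ∷ s) =
  cong (Product.map (addHead b) (b ∷_)) (split-merge (m+1+n≡1+o⇒m+n≡o 0 e) ([] , s))
split-merge {n = suc n} e (a ∷ r , b ∷ s) with b ≤? a
... | yes b≤a = trans (cong (Product.map (addHead b) (b ∷_)) (split-merge (m+1+n≡1+o⇒m+n≡o (suc _) e) (a ∸ b ∷ r , s)))
                      (cong (λ a′ → a′ ∷ r , b ∷ s) (m∸n+n≡m b≤a))
... | no  b≰a = trans (cong (Product.map (a ∷_) (addHead (suc a))) (split-merge (suc-injective e) (r , b ∸ suc a ∷ s)))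
                      (cong (λ b′ → a ∷ r , b′ ∷ s) (m∸n+n≡m (≰⇒> b≰a)))

merge↔ : ∀ i j → (Vec ℕ i × Vec ℕ j) ↔ (Vec ℕ (i + j) × Shuffle i j)
merge↔ i j = mk↔ₛ′ (merge refl) (split refl) (merge-split refl) (split-merge refl)

weightedSum-addHead : ∀ c (v : Vec ℕ n) → weightedSum (addHead c v) ≡ weightedSum v + n * c
weightedSum-addHead c []               = refl
weightedSum-addHead {suc n} c (y ∷ ys) = distrib (suc n) y c (weightedSum ys)
  where
  distrib : ∀ m y c w → m * (y + c) + w ≡ m * y + w + m * c
  distrib = solve-∀

-- gapsWeight (r , s) = |α| + |β| when α has gaps r for k = 1 and β has gaps s
-- for k = 0; shuffleWeight (t , σ) = |μ| + |ν| when μ has gaps t and ν = positions σ.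
gapsWeight : Vec ℕ i × Vec ℕ j → ℕ
gapsWeight {i} (r , s) = weightedSum r + triangle i + weightedSum s

shuffleWeight : Vec ℕ n × Shuffle i j → ℕ
shuffleWeight (t , σ) = weightedSum t + sum (positions σ)

split-weight : ∀ (e : i + j ≡ n) (tσ : Vec ℕ n × Shuffle i j) → shuffleWeight tσ ≡ gapsWeight (split e tσ)
split-weight _ ([] , []) = refl
split-weight () (_ ∷ _ , [])
split-weight () ([] , left _)
split-weight e ([] , right {i} _) = contradiction e (m+1+n≢0 i)
split-weight refl (c ∷ t , left {i} {j} σ) = begin
  suc (i + j) * c + weightedSum t + (i + j + sum (positions σ))   ≡⟨ regroupˡ (suc (i + j) * c) (i + j) _ _ ⟩
  shuffleWeight (t , σ) + Δ                                       ≡⟨ cong (_+ Δ) (split-weight refl (t , σ)) ⟩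
  weightedSum r + triangle i + weightedSum s + Δ                  ≡⟨ regroupʳ i j c _ _ _ ⟩
  suc i * c + weightedSum r + (i + triangle i) + (weightedSum s + j * suc c)
    ≡⟨ cong (suc i * c + weightedSum r + (i + triangle i) +_) (sym (weightedSum-addHead (suc c) s)) ⟩
  gapsWeight (c ∷ r , addHead (suc c) s)                          ∎
  where
  open ≡-Reasoning
  Δ = suc (i + j) * c + (i + j)
  r = proj₁ (split refl (t , σ))
  s = proj₂ (split refl (t , σ))
  regroupˡ : ∀ a b w p → a + w + (b + p) ≡ w + p + (a + b)
  regroupˡ = solve-∀
  regroupʳ : ∀ i j c w t v → w + t + v + (suc (i + j) * c + (i + j)) ≡ suc i * c + w + (i + t) + (v + j * suc c)
  regroupʳ = solve-∀
split-weight {n = suc n} e (c ∷ t , right {i} {j} σ) = begin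
  suc n * c + weightedSum t + sum (positions σ)                 ≡⟨ regroupˡ (suc n * c) _ _ ⟩
  shuffleWeight (t , σ) + suc n * c                             ≡⟨ cong₂ _+_ (split-weight e′ (t , σ)) (cong (_* c) (sym e)) ⟩
  weightedSum r + triangle i + weightedSum s + (i + suc j) * c  ≡⟨ regroupʳ i j c (weightedSum r) (triangle i) (weightedSum s) ⟩
  weightedSum r + i * c + triangle i + (suc j * c + weightedSum s)
    ≡⟨ cong (λ w → w + triangle i + (suc j * c + weightedSum s)) (sym (weightedSum-addHead c r)) ⟩
  gapsWeight (addHead c r , c ∷ s)                              ∎
  where
  open ≡-Reasoning
  e′ = m+1+n≡1+o⇒m+n≡o i e
  r = proj₁ (split e′ (t , σ))
  s = proj₂ (split e′ (t , σ))
  regroupˡ : ∀ a w p → a + w + p ≡ w + p + a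
  regroupˡ = solve-∀
  regroupʳ : ∀ i j c w t v → w + t + v + (i + suc j) * c ≡ w + i * c + t + (suc j * c + v)
  regroupʳ = solve-∀

merge-weight : ∀ (rs : Vec ℕ i × Vec ℕ j) → gapsWeight rs ≡ shuffleWeight (merge refl rs)
merge-weight rs = trans (cong gapsWeight (sym (split-merge refl rs))) (sym (split-weight refl (merge refl rs)))

bijection : ∀ i j → Domain i j ↔ Codomain i j
bijection i j =
  (spaced↔gaps 1 i ×-↔ spaced↔gaps 0 j) ⟨ ↔-trans ⟩ merge↔ i j ⟨ ↔-trans ⟩
  (↔-sym (spaced↔gaps 0 (i + j)) ×-↔ shuffle↔positions i j)

bijection-weight : ∀ (x : Domain i j) → weightD {i} {j} x ≡ weightC {i} {j} (Inverse.to (bijection i j) x)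
bijection-weight {i} {j} ((α , α>) , (β , β≥)) = begin
  sum α + sum β                                           ≡⟨ cong₂ _+_ (sum-spaced 1 α α>) (sum-spaced 0 β β≥) ⟩
  weightedSum r + 1 * triangle i + (weightedSum s + 0)    ≡⟨ cong₂ (λ a b → weightedSum r + a + b) (*-identityˡ _) (+-identityʳ _) ⟩
  gapsWeight (r , s)                                      ≡⟨ merge-weight (r , s) ⟩
  weightedSum t + sum (positions σ)                       ≡⟨ cong (_+ sum (positions σ)) (sum-fromGaps₀ t) ⟩
  sum (fromGaps 0 t) + sum (positions σ)                  ∎
  where
  open ≡-Reasoning
  r = toGaps 1 α
  s = toGaps 0 β
  t = proj₁ (merge refl (r , s))
  σ = proj₂ (merge refl (r , s))
  sum-fromGaps₀ : (t : Vec ℕ n) → weightedSum t ≡ sum (fromGaps 0 t)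
  sum-fromGaps₀ t = trans (sym (+-identityʳ _)) (sym (sum-fromGaps 0 t))

corollary2p2 : (i j : ℕ) →
    Σ (Domain i j ⤖ Codomain i j)
      (λ φ → ∀ x → weightD {i} {j} x ≡ weightC {i} {j} (Bijection.to φ x))
corollary2p2 i j = ↔⇒⤖ (bijection i j) , bijection-weight
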